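{- Let $T_u$ be a finite tree rooted at a vertex $u$, and let each vertex $v$ carry the triple $(\alpha_v,\beta_v,\gamma_v)$ defined recursively as follows: if $v\neq u$ has degree $1$ (a leaf of $T_u$), then $(\alpha_v,\beta_v,\gamma_v)=(1,0,1)$; otherwise, if $x_1,\dots,x_k$ are the children of $v$, then $\alpha_v=\prod_{i=1}^{k}\beta_{x_i}$, $\beta_v=\sum_{i=1}^{k}\Big(\prod_{j\neq i}(\alpha_{x_j}+\beta_{x_j})\Big)\gamma_{x_i}$, $\gamma_v=\prod_{i=1}^{k}(\alpha_{x_i}+\beta_{x_i})$. Then for every vertex $x\in V(T_u)$ we have $\alpha_x\leq\gamma_x$. Moreover, equality holds if and only if $x$ is a leaf of $T_u$, or every child $z$ of $x$ in $T_u$ is adjacent to a leaf of $T_u$.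
   Context: In a rooted tree $T_u$, a child of a vertex $v$ is a neighbour of $v$ not lying on the path from $u$ to $v$. The leaves of $T_u$ are the vertices other than the root $u$ having degree $1$. (For the root subtree $T_v$ consisting of $v$ and all its descendants, $\alpha_v$ equals the number of maximal matchings of $T_v$ not covering $v$, $\beta_v$ the number covering $v$, and $\gamma_v$ the number of maximal matchings of $T_v-v$.) -}

module Defs where

open import Data.Nat using (ℕ; _+_; _*_)
open import Data.Fin using (Fin; zero; suc)
open import Data.List using (List; []; _∷_; length; lookup; map; removeAt; allFin)
open import Data.Nat.ListAction using (sum; product)
open import Data.Product using (_×_; _,_; proj₁; proj₂; ∃)
open import Data.Sum using (_⊎_)
open import Relation.Binary.PropositionalEquality using (_≡_)
open import Relation.Nullary using (¬_)

-- Finite rooted trees (rose trees): a vertex together with the ordered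
-- list of its children.  The whole tree T_u is the value, u its root.
data Tree : Set where
  node : List Tree → Tree

children : Tree → List Tree
children (node ts) = ts

-- Vertices of a rooted tree t, given as paths from the root.
data Pos : Tree → Set where
  root  : ∀ {t} → Pos t
  child : ∀ {ts} (i : Fin (length ts)) → Pos (lookup ts i) → Pos (node ts)

sub : ∀ {t} → Pos t → Tree
sub {t} root = t
sub (child i p) = sub p

data IsChild : ∀ {t} → Pos t → Pos t → Set where
  root-child : ∀ {ts} (i : Fin (length ts)) → IsChild {node ts} root (child i root)
  step       : ∀ {ts} (i : Fin (length ts)) {p q : Pos (lookup ts i)} →
               IsChild p q → IsChild {node ts} (child i p) (child i q)

Adjacent : ∀ {t} → Pos t → Pos t → Set
Adjacent p q = IsChild p q ⊎ IsChild q p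

IsRoot : ∀ {t} → Pos t → Set
IsRoot root = Data.Unit.⊤ where import Data.Unit
IsRoot (child _ _) = Data.Empty.⊥ where import Data.Empty

-- Leaf of T_u: a non-root vertex of degree 1, i.e. a non-root vertex
-- whose only neighbour is its parent (it has no children).
IsLeaf : ∀ {t} → Pos t → Set
IsLeaf p = ¬ IsRoot p × children (sub p) ≡ []

Triple : Set
Triple = ℕ × ℕ × ℕ

α′ β′ γ′ : Triple → ℕ
α′ (a , b , c) = a
β′ (a , b , c) = b
γ′ (a , b , c) = c

combine : List Triple → Triple
combine L =
  product (map β′ L) ,
  sum (map (λ i → product (map (λ x → α′ x + β′ x) (removeAt L i)) * γ′ (lookup L i))
           (allFin (length L))) ,
  product (map (λ x → α′ x + β′ x) L)

mutual
  -- For a leaf (no children) this yields (1,0,1), as prescribed.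
  abg : Tree → Triple
  abg (node ts) = combine (abgs ts)

  abgs : List Tree → List Triple
  abgs [] = []
  abgs (t ∷ ts) = abg t ∷ abgs ts

α β γ : Tree → ℕ
α t = α′ (abg t)
β t = β′ (abg t)
γ t = γ′ (abg t)

-- γ is always positive and β_v vanishes exactly when v has no child.  Over the children z
-- of x, α_x = ∏ β_z ≤ ∏ (α_z + β_z) = γ_x factorwise; since every factor α_z + β_z is
-- positive, equality forces (and is implied by) α_z = 0 for every child z.  Finally
-- α_z = ∏ β_y over the children y of z vanishes iff some y is childless, i.e. a leaf
-- adjacent to z.
module Submission where

open import Defs
open import Data.Nat using (_≤_)
open import Data.Product using (_×_; ∃)
open import Data.Sum using (_⊎_)
open import Function.Bundles using (_⇔_)
open import Relation.Binary.PropositionalEquality using (_≡_)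

open import Data.Nat using (ℕ; suc; _+_; _*_; s≤s; NonZero; ≢-nonZero⁻¹)
open import Data.Nat.Properties
open import Data.Nat.ListAction using (product)
open import Data.Nat.ListAction.Properties using (product≢0)
open import Data.Fin using (Fin)
open import Data.List using ([]; _∷_; length; lookup; map)
open import Data.List.Properties using (map-∘; map-cong-local)
open import Data.List.Relation.Unary.All as All using (All; []; _∷_)
open import Data.List.Relation.Unary.All.Properties using (map⁺)
open import Data.List.Relation.Unary.Any as Any using (Any; here; there)
open import Data.List.Relation.Unary.Any.Properties using (lookup-index)
open import Data.List.Membership.Propositional using (_∈_; find; lose)
open import Data.List.Membership.Propositional.Properties using (∈-lookup)
open import Data.Product using (_,_)
open import Data.Sum using (inj₁; inj₂)
open import Data.Empty using (⊥-elim)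
open import Function.Base using (_∘_)
open import Function.Bundles using (mk⇔; Equivalence)
open import Relation.Binary.PropositionalEquality using (refl; sym; trans; cong; subst)
open import Relation.Nullary using (¬_)

open Equivalence

private
  variable
    A : Set
    a b c d : ℕ

nonZero-≤ : .{{_ : NonZero a}} → a ≤ b → NonZero b
nonZero-≤ {suc _} (s≤s _) = _

m≤n∧o≤p∧m*o≡n*p⇒m≡n∧o≡p : .{{_ : NonZero b}} .{{_ : NonZero d}} →
  a ≤ b → c ≤ d → a * c ≡ b * d → a ≡ b × c ≡ d
m≤n∧o≤p∧m*o≡n*p⇒m≡n∧o≡p {b} {d} {a} {c} a≤b c≤d ac≡bd =
  *-cancelʳ-≡ a b d (subst (λ e → a * e ≡ b * d) c≡d ac≡bd) , c≡d
  where
  bc≡bd : b * c ≡ b * d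
  bc≡bd = ≤-antisym (*-monoʳ-≤ b c≤d) (subst (_≤ b * c) ac≡bd (*-monoˡ-≤ c a≤b))
  c≡d : c ≡ d
  c≡d = *-cancelˡ-≡ c d b bc≡bd

n≡m+n⇔m≡0 : b ≡ a + b ⇔ a ≡ 0
n≡m+n⇔m≡0 {b} {a} =
  mk⇔ (λ b≡a+b → sym (+-cancelʳ-≡ b 0 a b≡a+b)) (λ a≡0 → cong (_+ b) (sym a≡0))

module _ {f g : A → ℕ} where

  product-map-≤ : (∀ x → f x ≤ g x) → ∀ xs → product (map f xs) ≤ product (map g xs)
  product-map-≤ f≤g []       = ≤-refl
  product-map-≤ f≤g (x ∷ xs) = *-mono-≤ (f≤g x) (product-map-≤ f≤g xs)

  product-map-≡⇔All : (∀ x → f x ≤ g x) → (∀ x → NonZero (g x)) → ∀ xs →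
    product (map f xs) ≡ product (map g xs) ⇔ All (λ x → f x ≡ g x) xs
  product-map-≡⇔All f≤g g≢0 xs = mk⇔ (pointwise xs) (cong product ∘ map-cong-local)
    where
    pointwise : ∀ xs → product (map f xs) ≡ product (map g xs) →
                All (λ x → f x ≡ g x) xs
    pointwise []       _  = []
    pointwise (x ∷ xs) eq =
      let fx≡gx , rest = m≤n∧o≤p∧m*o≡n*p⇒m≡n∧o≡p {{g≢0 x}}
                           {{product≢0 (map⁺ (All.universal g≢0 xs))}}
                           (f≤g x) (product-map-≤ f≤g xs) eq
      in fx≡gx ∷ pointwise xs rest

module _ {f : A → ℕ} where

  product-map-≡0⇒Any : ∀ xs → product (map f xs) ≡ 0 → Any (λ x → f x ≡ 0) xs
  product-map-≡0⇒Any (x ∷ xs) eq with m*n≡0⇒m≡0∨n≡0 (f x) eq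
  ... | inj₁ fx≡0 = here fx≡0
  ... | inj₂ rest = there (product-map-≡0⇒Any xs rest)

  Any⇒product-map-≡0 : ∀ {xs} → Any (λ x → f x ≡ 0) xs → product (map f xs) ≡ 0
  Any⇒product-map-≡0 {_ ∷ xs} (here fx≡0) = cong (_* product (map f xs)) fx≡0
  Any⇒product-map-≡0 {x ∷ _} (there any) =
    trans (cong (f x *_) (Any⇒product-map-≡0 any)) (*-zeroʳ (f x))

abgs≡map-abg : ∀ ts → abgs ts ≡ map abg ts
abgs≡map-abg []       = refl
abgs≡map-abg (t ∷ ts) = cong (abg t ∷_) (abgs≡map-abg ts)

α-node : ∀ ts → α (node ts) ≡ product (map β ts)
α-node ts = trans (cong (product ∘ map β′) (abgs≡map-abg ts)) (cong product (sym (map-∘ ts)))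

γ-node : ∀ ts → γ (node ts) ≡ product (map (λ t → α t + β t) ts)
γ-node ts = trans (cong (product ∘ map (λ x → α′ x + β′ x)) (abgs≡map-abg ts))
                  (cong product (sym (map-∘ ts)))

mutual
  γ-nonZero : ∀ t → NonZero (γ t)
  γ-nonZero (node ts) = γ-node-nonZero ts

  γ-node-nonZero : ∀ ts → NonZero (γ (node ts))
  γ-node-nonZero []       = _
  γ-node-nonZero (t ∷ ts) =
    m*n≢0 (α t + β t) (γ (node ts)) {{α+β-nonZero t}} {{γ-node-nonZero ts}}

  -- The i = 1 summand of β (node (t ∷ ts)) is γ (node ts) * γ t.
  β-nonZero : ∀ t ts → NonZero (β (node (t ∷ ts)))
  β-nonZero t ts =
    nonZero-≤ {{m*n≢0 (γ (node ts)) (γ t) {{γ-node-nonZero ts}} {{γ-nonZero t}}}} (m≤m+n _ _)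

  α+β-nonZero : ∀ t → NonZero (α t + β t)
  α+β-nonZero (node [])       = _
  α+β-nonZero (node (t ∷ ts)) = nonZero-≤ {{β-nonZero t ts}} (m≤n+m _ (α (node (t ∷ ts))))

Childless : Tree → Set
Childless t = children t ≡ []

β≡0⇔childless : ∀ t → β t ≡ 0 ⇔ Childless t
β≡0⇔childless (node [])       = mk⇔ (λ _ → refl) (λ _ → refl)
β≡0⇔childless (node (t ∷ ts)) = mk⇔ (⊥-elim ∘ ≢-nonZero⁻¹ _ {{β-nonZero t ts}}) λ ()

α≤γ : ∀ t → α t ≤ γ t
α≤γ (node ts) rewrite α-node ts | γ-node ts = product-map-≤ (λ t → m≤n+m (β t) (α t)) ts

childless⇒α≡γ : ∀ t → Childless t → α t ≡ γ t
childless⇒α≡γ (node []) _ = refl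

α≡γ⇔All-α≡0 : ∀ t → α t ≡ γ t ⇔ All (λ z → α z ≡ 0) (children t)
α≡γ⇔All-α≡0 (node ts) rewrite α-node ts | γ-node ts =
  mk⇔ (All.map (to n≡m+n⇔m≡0) ∘ to products) (from products ∘ All.map (from n≡m+n⇔m≡0))
  where
  products = product-map-≡⇔All (λ t → m≤n+m (β t) (α t)) α+β-nonZero ts

α≡0⇔Any-childless : ∀ t → α t ≡ 0 ⇔ Any Childless (children t)
α≡0⇔Any-childless (node ts) rewrite α-node ts =
  mk⇔ (Any.map (λ {y} → to (β≡0⇔childless y)) ∘ product-map-≡0⇒Any ts)
      (Any⇒product-map-≡0 ∘ Any.map (λ {y} → from (β≡0⇔childless y)))

childPos : ∀ {T} (p : Pos T) → Fin (length (children (sub p))) → Pos T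
childPos {node ts} root i = child i root
childPos (child j p) i    = child j (childPos p i)

childPos-sub : ∀ {T} (p : Pos T) i → sub (childPos p i) ≡ lookup (children (sub p)) i
childPos-sub {node ts} root i = refl
childPos-sub (child j p) i    = childPos-sub p i

childPos-isChild : ∀ {T} (p : Pos T) i → IsChild p (childPos p i)
childPos-isChild {node ts} root i = root-child i
childPos-isChild (child j p) i    = step j (childPos-isChild p i)

isChild⇒¬isRoot : ∀ {T} {p q : Pos T} → IsChild p q → ¬ IsRoot q
isChild⇒¬isRoot (root-child i) = λ ()
isChild⇒¬isRoot (step i c)     = λ ()

isChild⇒∈ : ∀ {T} {p q : Pos T} → IsChild p q → sub q ∈ children (sub p)
isChild⇒∈ (root-child i) = ∈-lookup i
isChild⇒∈ (step i c)     = isChild⇒∈ c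

∈⇒isChild : ∀ {T} (p : Pos T) {t} → t ∈ children (sub p) →
            ∃ λ q → IsChild p q × sub q ≡ t
∈⇒isChild p t∈ = childPos p (Any.index t∈) , childPos-isChild p _ ,
                 trans (childPos-sub p _) (sym (lookup-index t∈))

All-children⇔ : ∀ {T} (x : Pos T) {P : Tree → Set} →
  All P (children (sub x)) ⇔ ((z : Pos T) → IsChild x z → P (sub z))
All-children⇔ x {P} = mk⇔
  (λ all z z-child → All.lookup all (isChild⇒∈ z-child))
  (λ h → All.tabulate λ t∈ →
     let z , z-child , z≡t = ∈⇒isChild x t∈ in subst P z≡t (h z z-child))

AdjacentToLeaf : ∀ {T} → Pos T → Set
AdjacentToLeaf {T} z = ∃ λ (l : Pos T) → IsLeaf l × Adjacent z l

-- A leaf adjacent to z must be a child of z: a parent of z has a child.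
Any-childless⇔adjacentToLeaf : ∀ {T} (z : Pos T) →
  Any Childless (children (sub z)) ⇔ AdjacentToLeaf z
Any-childless⇔adjacentToLeaf z = mk⇔ adjacent-leaf childless-child
  where
  adjacent-leaf : Any Childless (children (sub z)) → AdjacentToLeaf z
  adjacent-leaf any with find any
  ... | y , y∈ , y-childless with ∈⇒isChild z y∈
  ...   | l , l-child , l≡y =
    l , (isChild⇒¬isRoot l-child , subst Childless (sym l≡y) y-childless) , inj₁ l-child

  childless-child : AdjacentToLeaf z → Any Childless (children (sub z))
  childless-child (l , (_ , l-childless) , inj₁ l-child) = lose (isChild⇒∈ l-child) l-childless
  childless-child (l , (_ , l-childless) , inj₂ z-child)
    with subst (sub z ∈_) l-childless (isChild⇒∈ z-child)
  ... | ()

α≡γ⇔children-adjacentToLeaf : ∀ {T} (x : Pos T) →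
  α (sub x) ≡ γ (sub x) ⇔ ((z : Pos T) → IsChild x z → AdjacentToLeaf z)
α≡γ⇔children-adjacentToLeaf x = mk⇔
  (λ eq z z-child → to (Any-childless⇔adjacentToLeaf z) (to (α≡0⇔Any-childless (sub z))
     (to (All-children⇔ x) (to (α≡γ⇔All-α≡0 (sub x)) eq) z z-child)))
  (λ h → from (α≡γ⇔All-α≡0 (sub x)) (from (All-children⇔ x) λ z z-child →
     from (α≡0⇔Any-childless (sub z)) (from (Any-childless⇔adjacentToLeaf z) (h z z-child))))

lemma3p1 : (T : Tree) (x : Pos T) →
    α (sub x) ≤ γ (sub x) ×
    (α (sub x) ≡ γ (sub x) ⇔
    (IsLeaf x ⊎ ((z : Pos T) → IsChild x z → ∃ λ (l : Pos T) → IsLeaf l × Adjacent z l)))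
lemma3p1 T x = α≤γ (sub x) , mk⇔ (inj₂ ∘ to (α≡γ⇔children-adjacentToLeaf x)) characterised
  where
  characterised : IsLeaf x ⊎ ((z : Pos T) → IsChild x z → AdjacentToLeaf z) →
                  α (sub x) ≡ γ (sub x)
  characterised (inj₁ (_ , x-childless)) = childless⇒α≡γ (sub x) x-childless
  characterised (inj₂ h)                 = from (α≡γ⇔children-adjacentToLeaf x) h
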